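{- For even $n\geq 2$, let $\mathrm{Dic}_n=\langle a,x \mid a^{2n}=e,\ x^2=a^n,\ x^{ -1}ax=a^{ -1}\rangle$ be the dicyclic group of order $4n$. Then Player 2 has a winning strategy for $\texttt{REL}(\mathrm{Dic}_n,\{a,x\})$.
   Context: Game $\texttt{REL}(G,S)$: $G$ is a finite group and $S$ a generating set with $e\notin S$. Two players alternate turns, Player 1 first, starting from the empty word $w_0$. On turn $n$ the current player chooses $s_n\in S\cup S^{ -1}$, subject to $s_n\neq s_{n-1}^{ -1}$ when $n>1$, and forms $w_n=w_{n-1}s_n$. If $w_n$ represents the same element of $G$ as some $w_k$ with $0\le k<n$, the player who formed $w_n$ wins. If a player has no legal move, that player loses. -}

module Defs where

open import Data.Nat using (ℕ; zero; suc; _+_; _*_; _∸_; _≤_; _<_; s≤s; z≤n; NonZero; _%_)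
open import Data.Nat.Base using (>-nonZero)
open import Data.Nat.Properties using (≤-trans)
open import Data.Fin using (Fin; toℕ; fromℕ<)
open import Data.Nat.DivMod using (_mod_)
open import Data.Bool using (Bool; true; false; _xor_; _∧_; if_then_else_)
open import Data.Product using (Σ; _×_; _,_)
open import Data.Sum using (_⊎_)
open import Data.Maybe using (Maybe; just; nothing)
open import Data.List using (List; []; _∷_; _++_; map)
open import Data.List.Membership.Propositional using (_∈_)
open import Relation.Binary.PropositionalEquality using (_≡_)
open import Relation.Nullary using (¬_)

-- Group elements are compared with propositional equality, so the
-- carrier must be a canonical model of G.

record GameData : Set₁ where
  field
    Carrier : Set
    _∙_     : Carrier → Carrier → Carrier
    ε       : Carrier
    _⁻¹     : Carrier → Carrier
    S       : List Carrier

  Moves : List Carrier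
  Moves = S ++ map _⁻¹ S

  record Pos : Set where
    constructor pos
    field
      cur  : Carrier
      past : List Carrier
      prev : Maybe Carrier

  open Pos public

  initial : Pos
  initial = pos ε [] nothing

  Legal : Maybe Carrier → Carrier → Set
  Legal nothing  m = m ∈ Moves
  Legal (just p) m = m ∈ Moves × ¬ (m ≡ p ⁻¹)

  Repeats : Pos → Carrier → Set
  Repeats p m = (cur p ∙ m) ∈ (cur p ∷ past p)

  step : Pos → Carrier → Pos
  step p m = pos (cur p ∙ m) (cur p ∷ past p) (just m)

  -- Win p  : the player to move at p has a winning strategy
  -- Lose p : the other player has a winning strategy
  --          (in particular, if there is no legal move, the mover loses)
  mutual
    data Win (p : Pos) : Set where
      win : (m : Carrier) → Legal (prev p) m →
            (Repeats p m ⊎ Lose (step p m)) → Win p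

    data Lose (p : Pos) : Set where
      lose : ((m : Carrier) → Legal (prev p) m →
               ¬ Repeats p m × Win (step p m)) → Lose p

  SecondPlayerWins : Set
  SecondPlayerWins = Lose initial

-- The dicyclic group Dic_n = ⟨ a, x ∣ a^{2n} = e, x² = aⁿ, x⁻¹ a x = a⁻¹ ⟩
-- modelled by normal forms a^i x^b, i ∈ Fin (2n), b ∈ Bool, with
--   (a^i x^b)(a^j x^c) = a^{i + (-1)^b j + [b ∧ c] n} x^{b xor c}.

private
  nz2 : (n : ℕ) → .{{NonZero n}} → NonZero (2 * n)
  nz2 (suc n) = _

module DicModel (n : ℕ) .{{nz : NonZero n}} where
  M : ℕ
  M = 2 * n

  instance
    nzM : NonZero M
    nzM = nz2 n

  Elt : Set
  Elt = Fin M × Bool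

  red : ℕ → Fin M
  red k = k mod M

  neg : Fin M → ℕ
  neg i = M ∸ toℕ i

  mul : Elt → Elt → Elt
  mul (i , b) (j , c) =
    red (toℕ i + (if b then neg j else toℕ j) + (if b ∧ c then n else 0))
    , b xor c

  e : Elt
  e = red 0 , false

  inv : Elt → Elt
  inv (i , false) = red (neg i) , false
  inv (i , true)  = red (toℕ i + n) , true

  a x : Elt
  a = red 1 , false
  x = red 0 , true

DicGame : (n : ℕ) → 2 ≤ n → GameData
DicGame n 2≤n = record
  { Carrier = Elt ; _∙_ = mul ; ε = e ; _⁻¹ = inv ; S = a ∷ x ∷ [] }
  where
  open DicModel n {{>-nonZero (≤-trans (s≤s z≤n) 2≤n)}}

-- Player 2 answers every letter by repeating it.  For even n, a ↦ (1,0), x ↦ (0,1) defines a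
-- homomorphism Dic_n → ℤ₂ × ℤ₂; let H be its kernel.  Player 2 always moves back into H, and a
-- single letter leaves H, so Player 1 always moves from an element c of H to an element c m outside H.
-- The only elements of H adjacent to c m are c and c m m (via m⁻¹).  Hence, inductively, every
-- edge from H into the earlier positions starts at an earlier position, except the edge undoing
-- Player 2's last letter, which is illegal; so Player 1 can never repeat.  Player 2's reply is
-- legal since no generator is an involution, and the group is finite, so Player 2 wins.
module Submission where

open import Defs
open import Data.Bool using (Bool; true; false; _xor_; _∧_; if_then_else_)
open import Data.Bool.Properties using (xor-same)
import Data.Bool as Bool
open import Data.Empty using (⊥-elim)
open import Data.Fin using (Fin; toℕ)
import Data.Fin as Fin
open import Data.Fin.Properties using (toℕ-fromℕ<; toℕ-injective; toℕ<n)
open import Data.List using (List; []; _∷_; cartesianProduct; allFin)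
open import Data.List.Membership.Propositional using (_∈_; _∉_)
open import Data.List.Membership.Propositional.Properties using (∈-cartesianProduct⁺; ∈-allFin)
open import Data.List.Relation.Unary.Any using (here; there)
open import Data.Maybe using (just; nothing)
open import Data.Nat using (ℕ; suc; _+_; _*_; _%_; _/_; _<_; _≤_; s≤s; z≤n; NonZero; parity; >-nonZero; >-nonZero⁻¹; ≢-nonZero⁻¹)
open import Data.Nat.Divisibility using (_∣_)
open import Data.Nat.DivMod using (_mod_; m%n<n; m%n%n≡m%n; [m+n]%n≡m%n; %-distribˡ-+; m≡m%n+[m/n]*n; m<n⇒m%n≡m)
open import Data.Nat.Properties using (m∸n+n≡m; <⇒≤; +-identityʳ; +-assoc; m<m+n; ≤-<-trans; ≤-trans)
open import Data.Nat.Tactic.RingSolver using (solve-∀)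
open import Data.Parity using (Parity; 0ℙ)
import Data.Parity as ℙ
import Data.Parity.Properties as ℙ
open import Data.Product using (Σ; _×_; _,_; proj₁; proj₂)
open import Data.Product.Properties using (≡-dec)
open import Data.Sum using (_⊎_; inj₁; inj₂)
open import Relation.Binary.Definitions using (DecidableEquality)
open import Relation.Binary.PropositionalEquality
open import Relation.Binary.PropositionalEquality.Properties using (decSetoid)
import Relation.Binary.Construct.On as On
import Relation.Binary.Reasoning.Setoid as SetoidReasoning
open import Relation.Nullary using (¬_; yes; no)
open import Function using (_∘_)

module RepetitionStrategy (G : GameData) where
  open GameData G

  module _
    (_≟_ : DecidableEquality Carrier)
    (elements : List Carrier) (elements-complete : ∀ g → g ∈ elements)
    (Home : Carrier → Set)
    (ε-home : Home ε)
    (move-leaves-home : ∀ {z s} → Home z → s ∈ Moves → ¬ Home (z ∙ s))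
    (repeated-move-returns-home : ∀ {c m} → Home c → m ∈ Moves → Home ((c ∙ m) ∙ m))
    (home-neighbours : ∀ {z c s m} → Home z → Home c → s ∈ Moves → m ∈ Moves →
                       z ∙ s ≡ c ∙ m → z ≡ c ⊎ (z ≡ (c ∙ m) ∙ m × s ≡ m ⁻¹))
    (move-not-involution : ∀ {m} → m ∈ Moves → m ≢ m ⁻¹)
    where

    open import Data.List.Countdown (decSetoid _≟_) using (_⊕_; emptyFromList; lookup; lookupOrInsert)

    count-fresh : ∀ {xs k x} → xs ⊕ k → x ∉ xs → Σ ℕ λ k′ → k ≡ suc k′ × (x ∷ xs) ⊕ k′
    count-fresh counted x∉ with lookupOrInsert counted _
    ... | inj₁ x∈       = ⊥-elim (x∉ x∈)
    ... | inj₂ counted′ = counted′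

    record Invariant (p : Pos) : Set where
      field
        home   : Home (cur p)
        fresh  : cur p ∉ past p
        closed : ∀ {z s} → Home z → s ∈ Moves → z ∙ s ∈ past p →
                 z ∈ past p ⊎ (z ≡ cur p × ¬ Legal (prev p) s)

    open Invariant

    legal⇒move : ∀ {pr m} → Legal pr m → m ∈ Moves
    legal⇒move {nothing} m∈      = m∈
    legal⇒move {just _}  (m∈ , _) = m∈

    repeat-legal : ∀ {pr m} → Legal pr m → Legal (just m) m
    repeat-legal legal = legal⇒move legal , move-not-involution (legal⇒move legal)

    first-move-fresh : ∀ {p m} → Invariant p → Legal (prev p) m → ¬ Repeats p m
    first-move-fresh I legal (here eq) =
      move-leaves-home (home I) (legal⇒move legal) (subst Home (sym eq) (home I))
    first-move-fresh I legal (there cm∈) with closed I (home I) (legal⇒move legal) cm∈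
    ... | inj₁ c∈           = fresh I c∈
    ... | inj₂ (_ , ¬legal) = ¬legal legal

    repetition-preserves-invariant : ∀ {p m} → Invariant p → Legal (prev p) m →
      ¬ Repeats (step p m) m → Invariant (step (step p m) m)
    repetition-preserves-invariant {p} {m} I legal ¬rep = record
      { home   = repeated-move-returns-home (home I) (legal⇒move legal)
      ; fresh  = ¬rep
      ; closed = closed′
      }
      where
      closed′ : ∀ {z s} → Home z → s ∈ Moves → z ∙ s ∈ (cur p ∙ m ∷ cur p ∷ past p) →
                z ∈ (cur p ∙ m ∷ cur p ∷ past p) ⊎ (z ≡ (cur p ∙ m) ∙ m × ¬ Legal (just m) s)
      closed′ z-home s∈ (here eq) with home-neighbours z-home (home I) s∈ (legal⇒move legal) eq
      ... | inj₁ z≡c          = inj₁ (there (here z≡c))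
      ... | inj₂ (z≡ , s≡m⁻¹) = inj₂ (z≡ , λ (_ , s≢m⁻¹) → s≢m⁻¹ s≡m⁻¹)
      closed′ z-home s∈ (there (here eq)) =
        ⊥-elim (move-leaves-home z-home s∈ (subst Home (sym eq) (home I)))
      closed′ z-home s∈ (there (there zs∈)) with closed I z-home s∈ zs∈
      ... | inj₁ z∈        = inj₁ (there (there z∈))
      ... | inj₂ (z≡c , _) = inj₁ (there (here z≡c))

    repetition-wins : ∀ k {p} → Invariant p → (cur p ∷ past p) ⊕ k → Lose p
    repetition-wins k {p} I counted = lose λ m legal →
      first-move-fresh I legal , win m (repeat-legal legal) (reply legal)
      where
      reply : ∀ {m} → Legal (prev p) m → Repeats (step p m) m ⊎ Lose (step (step p m) m)
      reply {m} legal with count-fresh counted (first-move-fresh I legal)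
      ... | _ , refl , counted′ with lookup counted′ ((cur p ∙ m) ∙ m)
      ...   | yes rep = inj₁ rep
      ...   | no ¬rep with count-fresh counted′ ¬rep
      ...     | k″ , refl , counted″ =
        inj₂ (repetition-wins k″ (repetition-preserves-invariant I legal ¬rep) counted″)

    initial-invariant : Invariant initial
    initial-invariant = record { home = ε-home ; fresh = λ () ; closed = λ _ _ () }

    second-player-wins : SecondPlayerWins
    second-player-wins with count-fresh (emptyFromList elements elements-complete) (λ ())
    ... | k , _ , counted = repetition-wins k initial-invariant counted

module Congruence (d : ℕ) .{{_ : NonZero d}} where

  infix 4 _≈_
  _≈_ : ℕ → ℕ → Set
  k ≈ l = k % d ≡ l % d

  module ≈-Reasoning = SetoidReasoning (On.setoid (setoid ℕ) (_% d))
  open ≈-Reasoning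

  +-cong≈ : ∀ {k k′ l l′} → k ≈ k′ → l ≈ l′ → k + l ≈ k′ + l′
  +-cong≈ {k} {k′} {l} {l′} k≈k′ l≈l′ = begin
    k + l             ≈⟨ %-distribˡ-+ k l d ⟩
    k % d + l % d     ≡⟨ cong₂ _+_ k≈k′ l≈l′ ⟩
    k′ % d + l′ % d   ≈⟨ %-distribˡ-+ k′ l′ d ⟨
    k′ + l′           ∎

  +d≈ : ∀ k → k + d ≈ k
  +d≈ k = [m+n]%n≡m%n k d

  ≈0-absorbʳ : ∀ k {l} → l ≈ 0 → k + l ≈ k
  ≈0-absorbʳ k {l} l≈0 = begin
    k + l   ≈⟨ +-cong≈ {k} refl l≈0 ⟩
    k + 0   ≡⟨ +-identityʳ k ⟩
    k       ∎

  ≈-<-≡ : ∀ {k l} → k < d → l < d → k ≈ l → k ≡ l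
  ≈-<-≡ k<d l<d k≈l = trans (sym (m<n⇒m%n≡m k<d)) (trans k≈l (m<n⇒m%n≡m l<d))

  toℕ-mod≈ : ∀ k → toℕ (k mod d) ≈ k
  toℕ-mod≈ k = trans (cong (_% d) (toℕ-fromℕ< _)) (m%n%n≡m%n k d)

  mod-≈ : ∀ {k} {i : Fin d} → k ≈ toℕ i → k mod d ≡ i
  mod-≈ {i = i} k≈i = toℕ-injective (trans (toℕ-fromℕ< _) (trans k≈i (m<n⇒m%n≡m (toℕ<n i))))

module DicLaws (n : ℕ) .{{_ : NonZero n}} where
  open DicModel n
  open Congruence M

  neg+toℕ : ∀ i → neg i + toℕ i ≡ M
  neg+toℕ i = m∸n+n≡m (<⇒≤ (toℕ<n i))

  neg-red+≈0 : ∀ k → neg (red k) + k ≈ 0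
  neg-red+≈0 k = begin
    neg (red k) + k             ≈⟨ +-cong≈ {neg (red k)} refl (toℕ-mod≈ k) ⟨
    neg (red k) + toℕ (red k)   ≡⟨ neg+toℕ (red k) ⟩
    M                           ≈⟨ +d≈ 0 ⟩
    0                           ∎
    where open ≈-Reasoning

  mul-inv-cancelʳ : ∀ u v → mul (mul u v) (inv v) ≡ u
  mul-inv-cancelʳ (i , false) (j , false) = cong (_, false) (mod-≈ (begin
    toℕ (red (toℕ i + toℕ j + 0)) + toℕ (red (neg j)) + 0
      ≈⟨ +-cong≈ (+-cong≈ (toℕ-mod≈ _) (toℕ-mod≈ _)) refl ⟩
    toℕ i + toℕ j + 0 + neg j + 0   ≡⟨ regroup (toℕ i) (toℕ j) (neg j) ⟩
    toℕ i + (neg j + toℕ j)         ≡⟨ cong (toℕ i +_) (neg+toℕ j) ⟩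
    toℕ i + M                       ≈⟨ +d≈ (toℕ i) ⟩
    toℕ i                           ∎))
    where
    open ≈-Reasoning
    regroup : ∀ a b c → a + b + 0 + c + 0 ≡ a + (c + b)
    regroup = solve-∀
  mul-inv-cancelʳ (i , true) (j , false) = cong (_, true) (mod-≈ (begin
    toℕ (red (toℕ i + neg j + 0)) + neg (red (neg j)) + 0
      ≈⟨ +-cong≈ (+-cong≈ (toℕ-mod≈ _) refl) refl ⟩
    toℕ i + neg j + 0 + neg (red (neg j)) + 0   ≡⟨ regroup (toℕ i) (neg j) (neg (red (neg j))) ⟩
    toℕ i + (neg (red (neg j)) + neg j)         ≈⟨ ≈0-absorbʳ (toℕ i) (neg-red+≈0 (neg j)) ⟩
    toℕ i                                       ∎))
    where
    open ≈-Reasoning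
    regroup : ∀ a b c → a + b + 0 + c + 0 ≡ a + (c + b)
    regroup = solve-∀
  mul-inv-cancelʳ (i , false) (j , true) = cong (_, false) (mod-≈ (begin
    toℕ (red (toℕ i + toℕ j + 0)) + neg (red (toℕ j + n)) + n
      ≈⟨ +-cong≈ (+-cong≈ (toℕ-mod≈ _) refl) refl ⟩
    toℕ i + toℕ j + 0 + neg (red (toℕ j + n)) + n   ≡⟨ regroup (toℕ i) (toℕ j) (neg (red (toℕ j + n))) n ⟩
    toℕ i + (neg (red (toℕ j + n)) + (toℕ j + n))   ≈⟨ ≈0-absorbʳ (toℕ i) (neg-red+≈0 (toℕ j + n)) ⟩
    toℕ i                                           ∎))
    where
    open ≈-Reasoning
    regroup : ∀ a b c d → a + b + 0 + c + d ≡ a + (c + (b + d))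
    regroup = solve-∀
  mul-inv-cancelʳ (i , true) (j , true) = cong (_, true) (mod-≈ (begin
    toℕ (red (toℕ i + neg j + n)) + toℕ (red (toℕ j + n)) + 0
      ≈⟨ +-cong≈ (+-cong≈ (toℕ-mod≈ _) (toℕ-mod≈ _)) refl ⟩
    toℕ i + neg j + n + (toℕ j + n) + 0   ≡⟨ regroup (toℕ i) (neg j) (toℕ j) n ⟩
    toℕ i + (neg j + toℕ j) + M           ≡⟨ cong (λ k → toℕ i + k + M) (neg+toℕ j) ⟩
    toℕ i + M + M                         ≈⟨ +d≈ (toℕ i + M) ⟩
    toℕ i + M                             ≈⟨ +d≈ (toℕ i) ⟩
    toℕ i                                 ∎))
    where
    open ≈-Reasoning
    regroup : ∀ a b c n → a + b + n + (c + n) + 0 ≡ a + (b + c) + 2 * n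
    regroup = solve-∀

  inv-involutive : ∀ u → inv (inv u) ≡ u
  inv-involutive (i , false) = cong (_, false) (mod-≈ (begin
    neg (red (neg i))                       ≈⟨ +d≈ _ ⟨
    neg (red (neg i)) + M                   ≡⟨ cong (neg (red (neg i)) +_) (neg+toℕ i) ⟨
    neg (red (neg i)) + (neg i + toℕ i)     ≡⟨ +-assoc (neg (red (neg i))) (neg i) (toℕ i) ⟨
    neg (red (neg i)) + neg i + toℕ i       ≈⟨ +-cong≈ (neg-red+≈0 (neg i)) refl ⟩
    toℕ i                                   ∎))
    where open ≈-Reasoning
  inv-involutive (i , true) = cong (_, true) (mod-≈ (begin
    toℕ (red (toℕ i + n)) + n   ≈⟨ +-cong≈ (toℕ-mod≈ _) refl ⟩
    toℕ i + n + n               ≡⟨ regroup (toℕ i) n ⟩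
    toℕ i + M                   ≈⟨ +d≈ (toℕ i) ⟩
    toℕ i                       ∎))
    where
    open ≈-Reasoning
    regroup : ∀ a n → a + n + n ≡ a + 2 * n
    regroup = solve-∀

  mul-solveʳ : ∀ {z s w} → mul z s ≡ w → z ≡ mul w (inv s)
  mul-solveʳ {z} {s} refl = sym (mul-inv-cancelʳ z s)

  mul-cancelʳ : ∀ {z c s} → mul z s ≡ mul c s → z ≡ c
  mul-cancelʳ {c = c} {s} eq = trans (mul-solveʳ eq) (mul-inv-cancelʳ c s)

  mul-inv-swapʳ : ∀ {z c m} → mul z (inv m) ≡ mul c m → z ≡ mul (mul c m) m
  mul-inv-swapʳ {c = c} {m} eq = trans (mul-solveʳ eq) (cong (mul (mul c m)) (inv-involutive m))

  moves : List Elt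
  moves = a ∷ x ∷ inv a ∷ inv x ∷ []

  pattern a∈   = here refl
  pattern x∈   = there (here refl)
  pattern a⁻¹∈ = there (there (here refl))
  pattern x⁻¹∈ = there (there (there (here refl)))

  same-letter : ∀ {s m} → s ∈ moves → m ∈ moves → proj₂ s ≡ proj₂ m → s ≡ m ⊎ s ≡ inv m
  same-letter a∈   a∈   _  = inj₁ refl
  same-letter a∈   a⁻¹∈ _  = inj₂ (sym (inv-involutive a))
  same-letter x∈   x∈   _  = inj₁ refl
  same-letter x∈   x⁻¹∈ _  = inj₂ (sym (inv-involutive x))
  same-letter a⁻¹∈ a∈   _  = inj₂ refl
  same-letter a⁻¹∈ a⁻¹∈ _  = inj₁ refl
  same-letter x⁻¹∈ x∈   _  = inj₂ refl
  same-letter x⁻¹∈ x⁻¹∈ _  = inj₁ refl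
  same-letter a∈   x∈   ()
  same-letter a∈   x⁻¹∈ ()
  same-letter x∈   a∈   ()
  same-letter x∈   a⁻¹∈ ()
  same-letter a⁻¹∈ x∈   ()
  same-letter a⁻¹∈ x⁻¹∈ ()
  same-letter x⁻¹∈ a∈   ()
  same-letter x⁻¹∈ a⁻¹∈ ()

  n<M : n < M
  n<M = m<m+n n (subst (0 <_) (sym (+-identityʳ n)) (>-nonZero⁻¹ n))

  move-not-involution : 2 ≤ n → ∀ {m} → m ∈ moves → m ≢ inv m
  move-not-involution 2≤n a∈ a≡a⁻¹ with ≈-<-≡ (≤-<-trans 2≤n n<M) (>-nonZero⁻¹ M) (begin
    1 + 1                        ≈⟨ +-cong≈ (toℕ-mod≈ 1) refl ⟨
    toℕ (red 1) + 1              ≡⟨ cong (λ g → toℕ (proj₁ g) + 1) a≡a⁻¹ ⟩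
    toℕ (red (neg (red 1))) + 1  ≈⟨ +-cong≈ (toℕ-mod≈ _) refl ⟩
    neg (red 1) + 1              ≈⟨ neg-red+≈0 1 ⟩
    0                            ∎)
    where open ≈-Reasoning
  ... | ()
  move-not-involution 2≤n x∈ x≡x⁻¹ = ≢-nonZero⁻¹ n (sym (≈-<-≡ (>-nonZero⁻¹ M) n<M (begin
    0                            ≈⟨ toℕ-mod≈ 0 ⟨
    toℕ (red 0)                  ≡⟨ cong (λ g → toℕ (proj₁ g)) x≡x⁻¹ ⟩
    toℕ (red (toℕ (red 0) + n))  ≈⟨ toℕ-mod≈ _ ⟩
    toℕ (red 0) + n              ≈⟨ +-cong≈ (toℕ-mod≈ 0) refl ⟩
    n                            ∎)))
    where open ≈-Reasoning
  move-not-involution 2≤n a⁻¹∈ eq = move-not-involution 2≤n a∈ (sym (trans eq (inv-involutive a)))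
  move-not-involution 2≤n x⁻¹∈ eq = move-not-involution 2≤n x∈ (sym (trans eq (inv-involutive x)))

  _≟_ : DecidableEquality Elt
  _≟_ = ≡-dec Fin._≟_ Bool._≟_

  elements : List Elt
  elements = cartesianProduct (allFin M) (false ∷ true ∷ [])

  elements-complete : ∀ g → g ∈ elements
  elements-complete (i , false) = ∈-cartesianProduct⁺ (∈-allFin i) (here refl)
  elements-complete (i , true)  = ∈-cartesianProduct⁺ (∈-allFin i) (there (here refl))

  parity-M : parity M ≡ 0ℙ
  parity-M = ℙ.*-homo-* 2 n

  parity-multiple-M : ∀ q → parity (q * M) ≡ 0ℙ
  parity-multiple-M q = begin
    parity (q * M)           ≡⟨ ℙ.*-homo-* q M ⟩
    parity q ℙ.* parity M    ≡⟨ cong (parity q ℙ.*_) parity-M ⟩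
    parity q ℙ.* 0ℙ          ≡⟨ ℙ.*-zeroʳ (parity q) ⟩
    0ℙ                       ∎
    where open ≡-Reasoning

  parity-toℕ-red : ∀ k → parity (toℕ (red k)) ≡ parity k
  parity-toℕ-red k = begin
    parity (toℕ (red k))                   ≡⟨ cong parity (toℕ-fromℕ< (m%n<n k M)) ⟩
    parity (k % M)                         ≡⟨ ℙ.+-identityʳ (parity (k % M)) ⟨
    parity (k % M) ℙ.+ 0ℙ                  ≡⟨ cong (parity (k % M) ℙ.+_) (parity-multiple-M (k / M)) ⟨
    parity (k % M) ℙ.+ parity (k / M * M)  ≡⟨ ℙ.+-homo-+ (k % M) (k / M * M) ⟨
    parity (k % M + k / M * M)             ≡⟨ cong parity (m≡m%n+[m/n]*n k M) ⟨
    parity k                               ∎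
    where open ≡-Reasoning

  parity-neg : ∀ i → parity (neg i) ≡ parity (toℕ i)
  parity-neg i = ℙ.+-cancelʳ-≡ (parity (toℕ i)) _ _ (begin
    parity (neg i) ℙ.+ parity (toℕ i)    ≡⟨ ℙ.+-homo-+ (neg i) (toℕ i) ⟨
    parity (neg i + toℕ i)               ≡⟨ cong parity (neg+toℕ i) ⟩
    parity M                             ≡⟨ parity-M ⟩
    0ℙ                                   ≡⟨ ℙ.p+p≡0ℙ (parity (toℕ i)) ⟨
    parity (toℕ i) ℙ.+ parity (toℕ i)    ∎)
    where open ≡-Reasoning

  parity-sign : ∀ b j → parity (if b then neg j else toℕ j) ≡ parity (toℕ j)
  parity-sign true  j = parity-neg j
  parity-sign false j = refl

  module Abelianisation (n-even : 2 ∣ n) where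

    parity-n : parity n ≡ 0ℙ
    parity-n = begin
      parity n                  ≡⟨ cong parity (_∣_.equality n-even) ⟩
      parity (q * 2)            ≡⟨ ℙ.*-homo-* q 2 ⟩
      parity q ℙ.* 0ℙ           ≡⟨ ℙ.*-zeroʳ (parity q) ⟩
      0ℙ                        ∎
      where
      open ≡-Reasoning
      q = _∣_.quotient n-even

    parity-twist : ∀ b c → parity (if b ∧ c then n else 0) ≡ 0ℙ
    parity-twist true  true  = parity-n
    parity-twist true  false = refl
    parity-twist false _     = refl

    infixl 7 _⊞_
    _⊞_ : Parity × Bool → Parity × Bool → Parity × Bool
    (p , b) ⊞ (q , c) = p ℙ.+ q , b xor c

    ⊞-self : ∀ g → g ⊞ g ≡ (0ℙ , false)
    ⊞-self (p , b) = cong₂ _,_ (ℙ.p+p≡0ℙ p) (xor-same b)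

    abelianise : Elt → Parity × Bool
    abelianise (i , b) = parity (toℕ i) , b

    abelianise-mul : ∀ u v → abelianise (mul u v) ≡ abelianise u ⊞ abelianise v
    abelianise-mul (i , b) (j , c) = cong (_, b xor c) (begin
      parity (toℕ (red (toℕ i + σ + τ)))   ≡⟨ parity-toℕ-red _ ⟩
      parity (toℕ i + σ + τ)               ≡⟨ ℙ.+-homo-+ (toℕ i + σ) τ ⟩
      parity (toℕ i + σ) ℙ.+ parity τ      ≡⟨ cong₂ ℙ._+_ (ℙ.+-homo-+ (toℕ i) σ) (parity-twist b c) ⟩
      parity (toℕ i) ℙ.+ parity σ ℙ.+ 0ℙ   ≡⟨ ℙ.+-identityʳ _ ⟩
      parity (toℕ i) ℙ.+ parity σ          ≡⟨ cong (parity (toℕ i) ℙ.+_) (parity-sign b j) ⟩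
      parity (toℕ i) ℙ.+ parity (toℕ j)    ∎)
      where
      open ≡-Reasoning
      σ = if b then neg j else toℕ j
      τ = if b ∧ c then n else 0

    abelianise-inv : ∀ u → abelianise (inv u) ≡ abelianise u
    abelianise-inv (i , false) = cong (_, false) (trans (parity-toℕ-red (neg i)) (parity-neg i))
    abelianise-inv (i , true)  = cong (_, true) (begin
      parity (toℕ (red (toℕ i + n)))   ≡⟨ parity-toℕ-red (toℕ i + n) ⟩
      parity (toℕ i + n)               ≡⟨ ℙ.+-homo-+ (toℕ i) n ⟩
      parity (toℕ i) ℙ.+ parity n      ≡⟨ cong (parity (toℕ i) ℙ.+_) parity-n ⟩
      parity (toℕ i) ℙ.+ 0ℙ            ≡⟨ ℙ.+-identityʳ _ ⟩
      parity (toℕ i)                   ∎)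
      where open ≡-Reasoning

    Home : Elt → Set
    Home u = abelianise u ≡ (0ℙ , false)

    e-home : Home e
    e-home = cong (_, false) (parity-toℕ-red 0)

    home-mul : ∀ {z s} → Home z → abelianise (mul z s) ≡ abelianise s
    home-mul {z} {s} z-home = trans (abelianise-mul z s) (cong (_⊞ abelianise s) z-home)

    ¬home-a : ¬ Home a
    ¬home-a a-home with trans (sym (parity-toℕ-red 1)) (cong proj₁ a-home)
    ... | ()

    ¬home-x : ¬ Home x
    ¬home-x ()

    move-not-home : ∀ {s} → s ∈ moves → ¬ Home s
    move-not-home a∈   = ¬home-a
    move-not-home x∈   = ¬home-x
    move-not-home a⁻¹∈ = ¬home-a ∘ trans (sym (abelianise-inv a))
    move-not-home x⁻¹∈ = ¬home-x ∘ trans (sym (abelianise-inv x))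

    move-leaves-home : ∀ {z s} → Home z → s ∈ moves → ¬ Home (mul z s)
    move-leaves-home z-home s∈ zs-home = move-not-home s∈ (trans (sym (home-mul z-home)) zs-home)

    repeated-move-returns-home : ∀ {c m} → Home c → Home (mul (mul c m) m)
    repeated-move-returns-home {c} {m} c-home =
      trans (abelianise-mul (mul c m) m)
            (trans (cong (_⊞ abelianise m) (home-mul c-home)) (⊞-self (abelianise m)))

    home-neighbours : ∀ {z c s m} → Home z → Home c → s ∈ moves → m ∈ moves →
                      mul z s ≡ mul c m → z ≡ c ⊎ (z ≡ mul (mul c m) m × s ≡ inv m)
    home-neighbours {c = c} z-home c-home s∈ m∈ eq
      with same-letter s∈ m∈ (cong proj₂ (trans (sym (home-mul z-home)) (trans (cong abelianise eq) (home-mul c-home))))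
    ... | inj₁ refl = inj₁ (mul-cancelʳ eq)
    ... | inj₂ refl = inj₂ (mul-inv-swapʳ {c = c} eq , refl)

theorem4p4 : (n : ℕ) → (h : 2 ≤ n) → 2 ∣ n →
    GameData.SecondPlayerWins (DicGame n h)
theorem4p4 n h n-even =
  RepetitionStrategy.second-player-wins (DicGame n h) _≟_ elements elements-complete Home e-home
    move-leaves-home (λ c-home _ → repeated-move-returns-home c-home) home-neighbours
    (move-not-involution h)
  where
  instance
    n-nonZero : NonZero n
    n-nonZero = >-nonZero (≤-trans (s≤s z≤n) h)
  open DicLaws n
  open Abelianisation n-even
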